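{- Let $n=2m>3$ be an even integer. The $n$-tuples of sides $(a,b,a,b,\ldots,a,b)$ represent different equivalence classes of $n$-polygons with $m$ axes if and only if $a$ and $b$ have the following four properties: (1) $a\in\mathbb{N}$ with $a\equiv 1\pmod 2$; (2) $b\in\mathbb{N}$ with $b\equiv 1\pmod 2$; (3) $1\le a<b\le n-1$; (4) $\gcd(a+b,n)=2$.
   Context: Fix the vertices $v_k=e^{2\pi i k/n}$, $k=0,\ldots,n-1$, on the unit circle. An $n$-polygon is a Hamiltonian cycle through these vertices: a closed path $v_{\sigma_1}\cdots v_{\sigma_n}v_{\sigma_1}$ of straight segments with $(\sigma_1,\ldots,\sigma_n)$ an ordering of $0,\ldots,n-1$. Its sides are the integers $e_i\in\{1,\ldots,n-1\}$ with $e_i\equiv\sigma_{i+1}-\sigma_i\pmod n$ ($\sigma_{n+1}=\sigma_1$); an $n$-tuple of sides represents a polygon if starting at a vertex and moving counterclockwise successively by the sides visits each vertex exactly once before returning to the start after the $n$-th step. Two $n$-polygons are equivalent if one is obtained from the other by a rotation about the center. An $n$-polygon with $m$ axes is one with exactly $m$ axes of reflection symmetry. -}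

module Defs where

open import Data.Nat using (ℕ; zero; suc; _+_; _*_; _∸_; _≤_; _<_)
open import Data.Nat.DivMod using (_%_)
open import Data.Nat.GCD using (gcd)
open import Data.Product using (Σ; ∃; _×_; _,_)
open import Data.Sum using (_⊎_)
open import Data.List using (List; length)
open import Data.List.Membership.Propositional using (_∈_)
open import Data.List.Relation.Unary.Unique.Propositional using (Unique)
open import Function.Bundles using (_⇔_)
open import Relation.Binary.PropositionalEquality using (_≡_)

-- reduction mod n (for n = 0 it is the identity; never used with n = 0)
_mod'_ : ℕ → ℕ → ℕ
x mod' zero = x
x mod' suc k = x % suc k

-- An n-tuple of sides is a function e : ℕ → ℕ, where e i (i < n) is the
-- (i+1)-st side e_{i+1}.  Values at i ≥ n are irrelevant.

walk : ℕ → (ℕ → ℕ) → ℕ → ℕ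
walk n e zero = 0
walk n e (suc i) = (walk n e i + e i) mod' n

-- the n-tuple e of sides represents an n-polygon: every side lies in
-- {1,…,n-1}, the walk visits each vertex exactly once during the first n
-- steps (positions 0,…,n-1 pairwise distinct) and returns to the start
-- after the n-th step
Represents : ℕ → (ℕ → ℕ) → Set
Represents n e =
  (∀ i → i < n → 1 ≤ e i × e i ≤ n ∸ 1)
  × (∀ i j → i < n → j < n → walk n e i ≡ walk n e j → i ≡ j)
  × walk n e n ≡ 0

alt : ℕ → ℕ → ℕ → ℕ
alt a b zero = a
alt a b (suc i) = alt b a i

-- A polygon is given by its ordering σ (σ i = σ_{i+1} for i < n):
-- closed path v_{σ 0} v_{σ 1} … v_{σ (n-1)} v_{σ 0}.
-- {x , y} is a side (as a segment) of the polygon σ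
IsEdge : ℕ → (ℕ → ℕ) → ℕ → ℕ → Set
IsEdge n σ x y = Σ ℕ λ i → i < n ×
  ((x ≡ σ i × y ≡ σ ((suc i) mod' n)) ⊎ (x ≡ σ ((suc i) mod' n) × y ≡ σ i))

-- reflection of the vertex set in the axis indexed by c :  v_k ↦ v_{c-k}
-- (these are the n reflection axes of the regular n-gon through the center)
reflect : ℕ → ℕ → ℕ → ℕ
reflect n c k = (c + (n ∸ k)) mod' n

IsAxis : ℕ → (ℕ → ℕ) → ℕ → Set
IsAxis n σ c = c < n ×
  (∀ i → i < n → IsEdge n σ (reflect n c (σ i)) (reflect n c (σ ((suc i) mod' n))))

HasExactlyAxes : ℕ → (ℕ → ℕ) → ℕ → Set
HasExactlyAxes n σ m = Σ (List ℕ) λ cs →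
  Unique cs × length cs ≡ m × (∀ c → (c ∈ cs) ⇔ IsAxis n σ c)

-- equivalence of n-polygons: τ is obtained from σ by a rotation about the
-- center (by r steps), the closed path being read from possibly another
-- starting vertex (cyclic shift s of the ordering)
Equivalent : ℕ → (ℕ → ℕ) → (ℕ → ℕ) → Set
Equivalent n σ τ = ∃ λ r → ∃ λ s →
  ∀ i → i < n → τ i ≡ (σ ((i + s) mod' n) + r) mod' n

Props : ℕ → ℕ → ℕ → Set
Props n a b =
  a % 2 ≡ 1 × b % 2 ≡ 1 × (1 ≤ a × a < b × b ≤ n ∸ 1) × gcd (a + b) n ≡ 2

-- Let s = a + b. After 2k steps the walk with sides a, b, a, b, … stands at k·s, and after
-- 2k + 1 steps at k·s + a (mod n). For odd a and b the position after i steps has the parity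
-- of i, so the walk is a polygon exactly when it closes up (n ∣ m·s) and k·s ≢ 0 for 0 < k < m,
-- i.e. when gcd(s, n) = 2; if a and b were even, only even vertices would be visited.
-- The reflection v ↦ c − v maps the side from σ_i to σ_{i+1} onto a side of the same length
-- traversed backwards. For odd c its new starting point has the parity of i, so it is again a
-- side of the polygon; for even c it would force 2a ≡ 2b ≡ 0 (mod n), i.e. a = b. Hence the
-- axes are the m odd c. Finally, a rotation only shifts the sequence of sides cyclically, and
-- a < b fixes the phase.
module Submission where

open import Defs
open import Data.Nat
open import Data.Nat.Properties
open import Data.Nat.DivMod hiding (_mod_)
open import Data.Nat.Divisibility
open import Data.Nat.GCD using (gcd; gcd-greatest; gcd[m,n]∣m; gcd[m,n]∣n; gcd[m,n]≢0; c*gcd[m,n]≡gcd[cm,cn])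
open import Data.Nat.Tactic.RingSolver using (solve-∀)
open import Data.Fin as Fin using (Fin; toℕ; fromℕ<; punchOut)
open import Data.Fin.Properties using (toℕ-fromℕ<; toℕ<n; toℕ-injective; any?; injective⇒≤; punchOut-injective)
open import Data.Product using (∃; _×_; _,_; proj₁; proj₂)
open import Data.Sum using (_⊎_; inj₁; inj₂)
import Data.Sum as Sum
open import Data.Empty using (⊥-elim)
open import Data.List using (List; map; upTo; length)
open import Data.List.Properties using (length-map; length-upTo)
open import Data.List.Membership.Propositional using (_∈_)
open import Data.List.Membership.Propositional.Properties using (∈-map⁺; ∈-map⁻; ∈-upTo⁺; ∈-upTo⁻)
open import Data.List.Relation.Unary.Unique.Propositional using (Unique)
open import Data.List.Relation.Unary.Unique.Propositional.Properties using (map⁺; upTo⁺)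
open import Function.Bundles using (_⇔_; mk⇔; Equivalence)
open import Relation.Nullary using (yes; no; ¬_)
open import Level using (0ℓ)
open import Relation.Binary using (IsEquivalence; Setoid)
import Relation.Binary.Reasoning.Setoid
open import Relation.Binary.PropositionalEquality

mod'-idem : ∀ n x → (x mod' n) mod' n ≡ x mod' n
mod'-idem zero    x = refl
mod'-idem (suc k) x = m%n%n≡m%n x (suc k)

mod'-distribˡ-+ : ∀ n x y → (x + y) mod' n ≡ (x mod' n + y mod' n) mod' n
mod'-distribˡ-+ zero    x y = refl
mod'-distribˡ-+ (suc k) x y = %-distribˡ-+ x y (suc k)

mod'<n : ∀ n x .{{_ : NonZero n}} → x mod' n < n
mod'<n (suc k) x = m%n<n x (suc k)

mod'-< : ∀ {n x} → x < n → x mod' n ≡ x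
mod'-< {suc k} x<n = m<n⇒m%n≡m x<n

mod'-self : ∀ n → n mod' n ≡ 0
mod'-self zero    = refl
mod'-self (suc k) = n%n≡0 (suc k)

-- A record rather than a synonym for  x mod' n ≡ y mod' n , so that x and y
-- can be inferred from the type.
infix 4 _≡_mod_
record _≡_mod_ (x y n : ℕ) : Set where
  constructor mod'-≡
  field ≡-mod' : x mod' n ≡ y mod' n
open _≡_mod_ public

≡mod-refl : ∀ {n x} → x ≡ x mod n
≡mod-refl = mod'-≡ refl

≡mod-sym : ∀ {n x y} → x ≡ y mod n → y ≡ x mod n
≡mod-sym (mod'-≡ p) = mod'-≡ (sym p)

≡mod-trans : ∀ {n x y z} → x ≡ y mod n → y ≡ z mod n → x ≡ z mod n
≡mod-trans (mod'-≡ p) (mod'-≡ q) = mod'-≡ (trans p q)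

≡mod-isEquivalence : ∀ n → IsEquivalence (λ x y → x ≡ y mod n)
≡mod-isEquivalence n = record { refl = ≡mod-refl ; sym = ≡mod-sym ; trans = ≡mod-trans }

≡mod-setoid : ℕ → Setoid 0ℓ 0ℓ
≡mod-setoid n = record { isEquivalence = ≡mod-isEquivalence n }

module ≡mod-Reasoning (n : ℕ) = Relation.Binary.Reasoning.Setoid (≡mod-setoid n)

≡⇒≡mod : ∀ {n x y} → x ≡ y → x ≡ y mod n
≡⇒≡mod refl = mod'-≡ refl

≡mod⇒≡ : ∀ {n x y} → x < n → y < n → x ≡ y mod n → x ≡ y
≡mod⇒≡ x<n y<n (mod'-≡ p) = trans (sym (mod'-< x<n)) (trans p (mod'-< y<n))

mod'-≡mod : ∀ n x → x mod' n ≡ x mod n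
mod'-≡mod n x = mod'-≡ (mod'-idem n x)

+-cong-≡mod : ∀ {n x x′ y y′} → x ≡ x′ mod n → y ≡ y′ mod n → x + y ≡ x′ + y′ mod n
+-cong-≡mod {n} {x} {x′} {y} {y′} (mod'-≡ p) (mod'-≡ q) = mod'-≡ (begin
  (x + y) mod' n                    ≡⟨ mod'-distribˡ-+ n x y ⟩
  (x mod' n + y mod' n) mod' n      ≡⟨ cong₂ (λ u v → (u + v) mod' n) p q ⟩
  (x′ mod' n + y′ mod' n) mod' n    ≡⟨ mod'-distribˡ-+ n x′ y′ ⟨
  (x′ + y′) mod' n                  ∎)
  where open ≡-Reasoning

∣⇒≡0mod : ∀ {n x} → n ∣ x → x ≡ 0 mod n
∣⇒≡0mod {zero}      0∣x = mod'-≡ (0∣⇒≡0 0∣x)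
∣⇒≡0mod {n@(suc _)} n∣x = mod'-≡ (n∣m⇒m%n≡0 _ n n∣x)

≡0mod⇒∣ : ∀ {n x} → x ≡ 0 mod n → n ∣ x
≡0mod⇒∣ {zero}      (mod'-≡ refl) = ∣-refl
≡0mod⇒∣ {n@(suc _)} (mod'-≡ p)    = m%n≡0⇒n∣m _ n p

+-inverse-≡mod : ∀ n .{{_ : NonZero n}} z → z + (n ∸ z mod' n) ≡ 0 mod n
+-inverse-≡mod n z = begin
  z + (n ∸ z mod' n)         ≈⟨ +-cong-≡mod (≡mod-sym (mod'-≡mod n z)) ≡mod-refl ⟩
  z mod' n + (n ∸ z mod' n)  ≡⟨ m+[n∸m]≡n (<⇒≤ (mod'<n n z)) ⟩
  n                          ≈⟨ ∣⇒≡0mod ∣-refl ⟩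
  0                          ∎
  where open ≡mod-Reasoning n

+-cancelʳ-≡mod : ∀ {n x y} z → x + z ≡ y + z mod n → x ≡ y mod n
+-cancelʳ-≡mod {zero}      {x} {y} z (mod'-≡ p) = mod'-≡ (+-cancelʳ-≡ z x y p)
+-cancelʳ-≡mod {n@(suc _)} {x} {y} z x+z≡y+z = begin
  x                ≡⟨ +-identityʳ x ⟨
  x + 0            ≈⟨ +-cong-≡mod (≡mod-refl {x = x}) (≡mod-sym (+-inverse-≡mod n z)) ⟩
  x + (z + w)      ≡⟨ +-assoc x z w ⟨
  x + z + w        ≈⟨ +-cong-≡mod x+z≡y+z (≡mod-refl {x = w}) ⟩
  y + z + w        ≡⟨ +-assoc y z w ⟩
  y + (z + w)      ≈⟨ +-cong-≡mod (≡mod-refl {x = y}) (+-inverse-≡mod n z) ⟩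
  y + 0            ≡⟨ +-identityʳ y ⟩
  y                ∎
  where
  open ≡mod-Reasoning n
  w : ℕ
  w = n ∸ z mod' n

+-cancelˡ-≡mod : ∀ {n x y} z → z + x ≡ z + y mod n → x ≡ y mod n
+-cancelˡ-≡mod {n} {x} {y} z z+x≡z+y =
  +-cancelʳ-≡mod z (subst₂ (λ u v → u ≡ v mod n) (+-comm z x) (+-comm z y) z+x≡z+y)

≡mod-∣ : ∀ {d n x y} → d ∣ n → x ≡ y mod n → x ≡ y mod d
≡mod-∣ {n = zero}                      _   (mod'-≡ refl) = ≡mod-refl
≡mod-∣ {zero}      {suc _}             0∣n _ with () ← 0∣⇒≡0 0∣n
≡mod-∣ {d@(suc _)} {n@(suc _)} {x} {y} d∣n (mod'-≡ p) = mod'-≡ (begin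
  x % d        ≡⟨ m∣n⇒o%n%m≡o%m d n x d∣n ⟨
  x % n % d    ≡⟨ cong (_% d) p ⟩
  y % n % d    ≡⟨ m∣n⇒o%n%m≡o%m d n y d∣n ⟩
  y % d        ∎)
  where open ≡-Reasoning

n+n≡0-mod2 : ∀ n → n + n ≡ 0 mod 2
n+n≡0-mod2 n = ∣⇒≡0mod (divides n (trans (cong (n +_) (sym (+-identityʳ n))) (*-comm 2 n)))

n≢1+n-mod2 : ∀ n → ¬ n ≡ suc n mod 2
n≢1+n-mod2 zero          (mod'-≡ ())
n≢1+n-mod2 (suc zero)    (mod'-≡ ())
n≢1+n-mod2 (suc (suc n)) (mod'-≡ p) = n≢1+n-mod2 n (mod'-≡ p)

mod2-cases : ∀ i → i ≡ 0 mod 2 ⊎ i ≡ 1 mod 2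
mod2-cases zero          = inj₁ ≡mod-refl
mod2-cases (suc zero)    = inj₂ ≡mod-refl
mod2-cases (suc (suc i)) with mod2-cases i
... | inj₁ (mod'-≡ p) = inj₁ (mod'-≡ p)
... | inj₂ (mod'-≡ p) = inj₂ (mod'-≡ p)

odd-decomposition : ∀ {i} → i ≡ 1 mod 2 → i ≡ suc (2 * (i / 2))
odd-decomposition {i} (mod'-≡ i%2≡1) = begin
  i                    ≡⟨ m≡m%n+[m/n]*n i 2 ⟩
  i % 2 + i / 2 * 2    ≡⟨ cong₂ _+_ i%2≡1 (*-comm (i / 2) 2) ⟩
  suc (2 * (i / 2))    ∎
  where open ≡-Reasoning

1+2*-mod2 : ∀ h → suc (2 * h) ≡ 1 mod 2
1+2*-mod2 h = +-cong-≡mod (≡mod-refl {x = 1}) (∣⇒≡0mod (divides h (*-comm 2 h)))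

1+2*<2*⇔< : ∀ {h m} → suc (2 * h) < 2 * m ⇔ h < m
1+2*<2*⇔< {h} {m} = mk⇔
  (λ 1+2h<2m → *-cancelˡ-< 2 h m (<-trans (n<1+n (2 * h)) 1+2h<2m))
  (λ h<m → <-≤-trans (subst (suc (2 * h) <_) (sym (2*suc h)) (n<1+n _)) (*-monoʳ-≤ 2 h<m))
  where
  2*suc : ∀ h → 2 * suc h ≡ 2 + 2 * h
  2*suc = solve-∀

odds-below : ℕ → List ℕ
odds-below m = map (λ h → suc (2 * h)) (upTo m)

odds-below-unique : ∀ m → Unique (odds-below m)
odds-below-unique m = map⁺ (λ eq → *-cancelˡ-≡ _ _ 2 (suc-injective eq)) (upTo⁺ m)

length-odds-below : ∀ m → length (odds-below m) ≡ m
length-odds-below m = trans (length-map _ (upTo m)) (length-upTo m)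

∈-odds-below : ∀ {m c} → c ∈ odds-below m ⇔ (c ≡ 1 mod 2 × c < 2 * m)
∈-odds-below {m} {c} = mk⇔ listed⇒odd odd⇒listed
  where
  listed⇒odd : c ∈ odds-below m → c ≡ 1 mod 2 × c < 2 * m
  listed⇒odd c∈ with ∈-map⁻ _ c∈
  ... | h , h∈ , refl = 1+2*-mod2 h , Equivalence.from 1+2*<2*⇔< (∈-upTo⁻ h∈)
  odd⇒listed : c ≡ 1 mod 2 × c < 2 * m → c ∈ odds-below m
  odd⇒listed (c≡1 , c<2m) = subst (_∈ odds-below m) (sym c≡1+2h)
    (∈-map⁺ _ (∈-upTo⁺ (Equivalence.to (1+2*<2*⇔< {c / 2}) (subst (_< 2 * m) c≡1+2h c<2m))))
    where
    c≡1+2h : c ≡ suc (2 * (c / 2))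
    c≡1+2h = odd-decomposition c≡1

∣-*-gcd : ∀ {n k s} → n ∣ k * s → n ∣ k * gcd s n
∣-*-gcd {n} {k} {s} n∣ks =
  subst (n ∣_) (sym (c*gcd[m,n]≡gcd[cm,cn] k s n)) (gcd-greatest n∣ks (n∣m*n k))

m+m≡0-mod⇒m+m≡n : ∀ {n x} → 0 < x → x < n → x + x ≡ 0 mod n → x + x ≡ n
m+m≡0-mod⇒m+m≡n {n} {x} 0<x x<n x+x≡0 with ≡0mod⇒∣ x+x≡0
... | divides zero          x+x≡0 = ⊥-elim (<-irrefl (sym (m+n≡0⇒m≡0 x x+x≡0)) 0<x)
... | divides (suc zero)    x+x≡n = trans x+x≡n (*-identityˡ n)
... | divides (suc (suc q)) x+x≡q+2*n = ⊥-elim (<-irrefl refl (<-≤-trans (+-mono-< x<n x<n)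
        (subst (n + n ≤_) (sym x+x≡q+2*n) (+-monoʳ-≤ n (m≤m+n n (q * n))))))

Fin-injective⇒surjective : ∀ {n} {f : Fin n → Fin n} →
  (∀ {i j} → f i ≡ f j → i ≡ j) → ∀ y → ∃ λ i → f i ≡ y
Fin-injective⇒surjective {suc n} {f} f-inj y with any? (λ i → f i Fin.≟ y)
... | yes y∈image = y∈image
... | no  y∉image = ⊥-elim (<-irrefl refl (injective⇒≤ g-injective))
  where
  y≢f : ∀ i → y ≢ f i
  y≢f i y≡fi = y∉image (i , sym y≡fi)
  g : Fin (suc n) → Fin n
  g i = punchOut (y≢f i)
  g-injective : ∀ {i j} → g i ≡ g j → i ≡ j
  g-injective {i} {j} gi≡gj = f-inj (punchOut-injective (y≢f i) (y≢f j) gi≡gj)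

injective⇒surjective : ∀ n (f : ℕ → ℕ) → (∀ i → f i < n) →
  (∀ i j → i < n → j < n → f i ≡ f j → i ≡ j) →
  ∀ y → y < n → ∃ λ j → j < n × f j ≡ y
injective⇒surjective n f f<n f-inj y y<n =
  preimage (Fin-injective⇒surjective F-injective (fromℕ< y<n))
  where
  F : Fin n → Fin n
  F i = fromℕ< (f<n (toℕ i))
  toℕ-F : ∀ i → toℕ (F i) ≡ f (toℕ i)
  toℕ-F i = toℕ-fromℕ< (f<n (toℕ i))
  F-injective : ∀ {i j} → F i ≡ F j → i ≡ j
  F-injective {i} {j} Fi≡Fj = toℕ-injective (f-inj _ _ (toℕ<n i) (toℕ<n j)
    (trans (sym (toℕ-F i)) (trans (cong toℕ Fi≡Fj) (toℕ-F j))))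
  preimage : (∃ λ i → F i ≡ fromℕ< y<n) → ∃ λ j → j < n × f j ≡ y
  preimage (i , Fi≡y) =
    toℕ i , toℕ<n i , trans (sym (toℕ-F i)) (trans (cong toℕ Fi≡y) (toℕ-fromℕ< y<n))

alt-all : ∀ (P : ℕ → Set) {a b} → P a → P b → ∀ i → P (alt a b i)
alt-all P pa pb zero    = pa
alt-all P pa pb (suc i) = alt-all P pb pa i

alt-+-suc : ∀ a b i → alt a b i + alt a b (suc i) ≡ a + b
alt-+-suc a b zero    = refl
alt-+-suc a b (suc i) = trans (alt-+-suc b a i) (+-comm b a)

alt-%2 : ∀ a b i → alt a b i ≡ alt a b (i % 2)
alt-%2 a b zero          = refl
alt-%2 a b (suc zero)    = refl
alt-%2 a b (suc (suc i)) = alt-%2 a b i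

alt-cong-mod2 : ∀ a b {i j} → i ≡ j mod 2 → alt a b i ≡ alt a b j
alt-cong-mod2 a b {i} {j} (mod'-≡ p) =
  trans (alt-%2 a b i) (trans (cong (alt a b) p) (sym (alt-%2 a b j)))

alt-cases : ∀ a b i → alt a b i ≡ a ⊎ alt a b i ≡ b
alt-cases a b i with mod2-cases i
... | inj₁ i≡0 = inj₁ (alt-cong-mod2 a b i≡0)
... | inj₂ i≡1 = inj₂ (alt-cong-mod2 a b i≡1)

alt-injective-mod2 : ∀ {a b i j} → a ≢ b → alt a b i ≡ alt a b j → i ≡ j mod 2
alt-injective-mod2 {a} {b} {i} {j} a≢b eq with mod2-cases i | mod2-cases j
... | inj₁ i≡0 | inj₁ j≡0 = ≡mod-trans i≡0 (≡mod-sym j≡0)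
... | inj₂ i≡1 | inj₂ j≡1 = ≡mod-trans i≡1 (≡mod-sym j≡1)
... | inj₁ i≡0 | inj₂ j≡1 = ⊥-elim (a≢b (trans (alt-cong-mod2 a b (≡mod-sym i≡0))
                              (trans eq (alt-cong-mod2 a b j≡1))))
... | inj₂ i≡1 | inj₁ j≡0 = ⊥-elim (a≢b (trans (alt-cong-mod2 a b (≡mod-sym j≡0))
                              (trans (sym eq) (alt-cong-mod2 a b i≡1))))

walk-suc : ∀ n e i → walk n e (suc i) ≡ walk n e i + e i mod n
walk-suc n e i = mod'-≡mod n _

walk<n : ∀ n .{{_ : NonZero n}} e i → walk n e i < n
walk<n n e zero    = >-nonZero⁻¹ n
walk<n n e (suc i) = mod'<n n _

walk-next : ∀ n e {i} → walk n e n ≡ 0 → i < n →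
  walk n e (suc i mod' n) ≡ walk n e i + e i mod n
walk-next n e {i} closed i<n with m≤n⇒m<n∨m≡n i<n
... | inj₁ 1+i<n rewrite mod'-< 1+i<n = walk-suc n e i
... | inj₂ refl  rewrite mod'-self (suc i) = ≡mod-trans (≡⇒≡mod (sym closed)) (walk-suc n e i)

module AltWalk (n a b : ℕ) where

  private
    W : ℕ → ℕ
    W = walk n (alt a b)

  walk-alt-2+ : ∀ i → W (2 + i) ≡ W i + (a + b) mod n
  walk-alt-2+ i = begin
    W (2 + i)                                ≈⟨ walk-suc n _ (suc i) ⟩
    W (suc i) + alt a b (suc i)              ≈⟨ +-cong-≡mod (walk-suc n _ i) ≡mod-refl ⟩
    W i + alt a b i + alt a b (suc i)        ≡⟨ +-assoc (W i) _ _ ⟩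
    W i + (alt a b i + alt a b (suc i))      ≡⟨ cong (W i +_) (alt-+-suc a b i) ⟩
    W i + (a + b)                            ∎
    where open ≡mod-Reasoning n

  walk-alt-2*+ : ∀ k i → W (2 * k + i) ≡ k * (a + b) + W i mod n
  walk-alt-2*+ zero    i = ≡mod-refl
  walk-alt-2*+ (suc k) i = begin
    W (2 * suc k + i)                 ≡⟨ cong W (index k i) ⟩
    W (2 + (2 * k + i))               ≈⟨ walk-alt-2+ (2 * k + i) ⟩
    W (2 * k + i) + (a + b)           ≈⟨ +-cong-≡mod (walk-alt-2*+ k i) ≡mod-refl ⟩
    k * (a + b) + W i + (a + b)       ≡⟨ coefficient k (a + b) (W i) ⟩
    suc k * (a + b) + W i             ∎
    where
    open ≡mod-Reasoning n
    index : ∀ k i → 2 * suc k + i ≡ 2 + (2 * k + i)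
    index = solve-∀
    coefficient : ∀ k s w → k * s + w + s ≡ suc k * s + w
    coefficient = solve-∀

  walk-alt-2* : ∀ k → W (2 * k) ≡ k * (a + b) mod n
  walk-alt-2* k = subst₂ (λ u v → W u ≡ v mod n) (+-identityʳ (2 * k)) (+-identityʳ (k * (a + b)))
    (walk-alt-2*+ k 0)

  walk-alt-mod2 : 2 ∣ n → ∀ {p} → a ≡ p mod 2 → b ≡ p mod 2 → ∀ i → W i ≡ i * p mod 2
  walk-alt-mod2 2∣n a≡p b≡p zero    = ≡mod-refl
  walk-alt-mod2 2∣n {p} a≡p b≡p (suc i) = begin
    W (suc i)          ≈⟨ ≡mod-∣ 2∣n (walk-suc n _ i) ⟩
    W i + alt a b i    ≈⟨ +-cong-≡mod (walk-alt-mod2 2∣n a≡p b≡p i)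
                                      (alt-all (λ x → x ≡ p mod 2) a≡p b≡p i) ⟩
    i * p + p          ≡⟨ +-comm (i * p) p ⟩
    suc i * p          ∎
    where open ≡mod-Reasoning 2

reflect<n : ∀ n .{{_ : NonZero n}} c v → reflect n c v < n
reflect<n n c v = mod'<n n _

reflect-+ : ∀ n c {v} → v ≤ n → reflect n c v + v ≡ c mod n
reflect-+ n c {v} v≤n = begin
  reflect n c v + v    ≈⟨ +-cong-≡mod (mod'-≡mod n _) ≡mod-refl ⟩
  c + (n ∸ v) + v      ≡⟨ +-assoc c (n ∸ v) v ⟩
  c + (n ∸ v + v)      ≡⟨ cong (c +_) (m∸n+n≡m v≤n) ⟩
  c + n                ≈⟨ +-cong-≡mod (≡mod-refl {x = c}) (∣⇒≡0mod ∣-refl) ⟩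
  c + 0                ≡⟨ +-identityʳ c ⟩
  c                    ∎
  where open ≡mod-Reasoning n

reflect-mod2 : ∀ {n} c {v} → 2 ∣ n → v ≤ n → reflect n c v ≡ c + v mod 2
reflect-mod2 {n} c {v} 2∣n v≤n = +-cancelʳ-≡mod v (begin
  reflect n c v + v    ≈⟨ ≡mod-∣ 2∣n (reflect-+ n c v≤n) ⟩
  c                    ≡⟨ +-identityʳ c ⟨
  c + 0                ≈⟨ +-cong-≡mod (≡mod-refl {x = c}) (≡mod-sym (n+n≡0-mod2 v)) ⟩
  c + (v + v)          ≡⟨ +-assoc c v v ⟨
  c + v + v            ∎)
  where open ≡mod-Reasoning 2

-- The reflected image of the side from σ i to σ (i + 1) runs backwards.
reflect-walk-next : ∀ n .{{_ : NonZero n}} e c {i} → walk n e n ≡ 0 → i < n →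
  reflect n c (walk n e (suc i mod' n)) + e i ≡ reflect n c (walk n e i) mod n
reflect-walk-next n e c {i} closed i<n = +-cancelʳ-≡mod (W i) (begin
  y + e i + W i        ≡⟨ +-assoc y (e i) (W i) ⟩
  y + (e i + W i)      ≡⟨ cong (y +_) (+-comm (e i) (W i)) ⟩
  y + (W i + e i)      ≈⟨ +-cong-≡mod (≡mod-refl {x = y}) (≡mod-sym (walk-next n e closed i<n)) ⟩
  y + W (suc i mod' n) ≈⟨ reflect-+ n c (<⇒≤ (walk<n n e (suc i mod' n))) ⟩
  c                    ≈⟨ ≡mod-sym (reflect-+ n c (<⇒≤ (walk<n n e i))) ⟩
  x + W i              ∎)
  where
  open ≡mod-Reasoning n
  W : ℕ → ℕ
  W = walk n e
  x y : ℕ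
  x = reflect n c (W i)
  y = reflect n c (W (suc i mod' n))

module Sufficient (m : ℕ) {{_ : NonZero m}} {a b : ℕ} (props : Props (2 * m) a b) where

  a<b : a < b
  a<b = proj₁ (proj₂ (proj₁ (proj₂ (proj₂ props))))

  private
    a-odd : a % 2 ≡ 1
    a-odd = proj₁ props
    b-odd : b % 2 ≡ 1
    b-odd = proj₁ (proj₂ props)
    1≤a : 1 ≤ a
    1≤a = proj₁ (proj₁ (proj₂ (proj₂ props)))
    b≤n∸1 : b ≤ 2 * m ∸ 1
    b≤n∸1 = proj₂ (proj₂ (proj₁ (proj₂ (proj₂ props))))
    gcd≡2 : gcd (a + b) (2 * m) ≡ 2
    gcd≡2 = proj₂ (proj₂ (proj₂ props))
    n s : ℕ
    n = 2 * m
    s = a + b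
    e W V : ℕ → ℕ
    e = alt a b
    W = walk n e
    V i = W (suc i mod' n)
    instance
      n≢0 : NonZero n
      n≢0 = m*n≢0 2 m

  open AltWalk n a b

  2∣n : 2 ∣ n
  2∣n = m∣m*n m

  b<n : b < n
  b<n = m≤pred[n]⇒suc[m]≤n b≤n∸1

  sides-range : ∀ i → 1 ≤ e i × e i ≤ n ∸ 1
  sides-range = alt-all (λ x → 1 ≤ x × x ≤ n ∸ 1)
    (1≤a , <⇒≤pred (<-trans a<b b<n)) (≤-trans 1≤a (<⇒≤ a<b) , b≤n∸1)

  sides<n : ∀ i → e i < n
  sides<n i = m≤pred[n]⇒suc[m]≤n (proj₂ (sides-range i))

  sides-odd : ∀ i → e i ≡ 1 mod 2
  sides-odd = alt-all (λ x → x ≡ 1 mod 2) (mod'-≡ a-odd) (mod'-≡ b-odd)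

  walk-mod2 : ∀ i → W i ≡ i mod 2
  walk-mod2 i = ≡mod-trans (walk-alt-mod2 2∣n (mod'-≡ a-odd) (mod'-≡ b-odd) i)
                           (≡⇒≡mod (*-identityʳ i))

  closed : W n ≡ 0
  closed = ≡mod⇒≡ (walk<n n e n) (>-nonZero⁻¹ n) (begin
    W (2 * m)    ≈⟨ walk-alt-2* m ⟩
    m * s        ≈⟨ ∣⇒≡0mod (subst (_∣ m * s) (*-comm m 2) (*-monoʳ-∣ m 2∣s)) ⟩
    0            ∎)
    where
    open ≡mod-Reasoning n
    2∣s : 2 ∣ s
    2∣s = subst (_∣ s) gcd≡2 (gcd[m,n]∣m s n)

  k*s≡0⇒k≡0 : ∀ {k} → k * s ≡ 0 mod n → k < m → k ≡ 0
  k*s≡0⇒k≡0 {zero}  _      _   = refl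
  k*s≡0⇒k≡0 {suc k} ks≡0 k<m = ⊥-elim (>⇒∤ k<m m∣k)
    where
    m∣k : m ∣ suc k
    m∣k = *-cancelʳ-∣ 2 (subst₂ _∣_ (*-comm 2 m) (cong (suc k *_) gcd≡2)
                           (∣-*-gcd {k = suc k} {s} (≡0mod⇒∣ ks≡0)))

  W[2q+i]≡W[i]⇒q≡0 : ∀ q i → 2 * q + i < n → W (2 * q + i) ≡ W i → q ≡ 0
  W[2q+i]≡W[i]⇒q≡0 q i 2q+i<n W[2q+i]≡Wi = k*s≡0⇒k≡0 (+-cancelʳ-≡mod (W i) (begin
    q * s + W i     ≈⟨ ≡mod-sym (walk-alt-2*+ q i) ⟩
    W (2 * q + i)   ≡⟨ W[2q+i]≡Wi ⟩
    W i             ∎)) q<m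
    where
    open ≡mod-Reasoning n
    q<m : q < m
    q<m = *-cancelˡ-< 2 q m (≤-<-trans (m≤m+n (2 * q) i) 2q+i<n)

  injective-≤ : ∀ {i j} → i ≤ j → j < n → W i ≡ W j → i ≡ j
  injective-≤ {i} {j} i≤j j<n Wi≡Wj = sym (trans j≡2q+i (cong (λ q → 2 * q + i) q≡0))
    where
    d-even : j ∸ i ≡ 0 mod 2
    d-even = +-cancelʳ-≡mod i (begin
      j ∸ i + i    ≡⟨ m∸n+n≡m i≤j ⟩
      j            ≈⟨ ≡mod-sym (walk-mod2 j) ⟩
      W j          ≡⟨ Wi≡Wj ⟨
      W i          ≈⟨ walk-mod2 i ⟩
      i            ∎)
      where open ≡mod-Reasoning 2
    q : ℕ
    q = quotient (≡0mod⇒∣ d-even)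
    j≡2q+i : j ≡ 2 * q + i
    j≡2q+i = trans (sym (m∸n+n≡m i≤j))
                   (cong (_+ i) (trans (m∣n⇒n≡quotient*m (≡0mod⇒∣ d-even)) (*-comm q 2)))
    q≡0 : q ≡ 0
    q≡0 = W[2q+i]≡W[i]⇒q≡0 q i (subst (_< n) j≡2q+i j<n) (trans (cong W (sym j≡2q+i)) (sym Wi≡Wj))

  injective : ∀ i j → i < n → j < n → W i ≡ W j → i ≡ j
  injective i j i<n j<n Wi≡Wj with ≤-total i j
  ... | inj₁ i≤j = injective-≤ i≤j j<n Wi≡Wj
  ... | inj₂ j≤i = sym (injective-≤ j≤i i<n (sym Wi≡Wj))

  represents : Represents n e
  represents = (λ i _ → sides-range i) , injective , closed

  next-mod2 : ∀ {i} → i < n → V i ≡ suc i mod 2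
  next-mod2 {i} i<n = begin
    V i          ≈⟨ ≡mod-∣ 2∣n (walk-next n e closed i<n) ⟩
    W i + e i    ≈⟨ +-cong-≡mod (walk-mod2 i) (sides-odd i) ⟩
    i + 1        ≡⟨ +-comm i 1 ⟩
    suc i        ∎
    where open ≡mod-Reasoning 2

  reflect-walk-mod2 : ∀ c k → reflect n c (W k) ≡ c + W k mod 2
  reflect-walk-mod2 c k = reflect-mod2 c 2∣n (<⇒≤ (walk<n n e k))

  reflect-walk-even : ∀ {c} → c ≡ 0 mod 2 → ∀ i → reflect n c (W i) ≡ i mod 2
  reflect-walk-even {c} c≡0 i = begin
    reflect n c (W i)    ≈⟨ reflect-walk-mod2 c i ⟩
    c + W i              ≈⟨ +-cong-≡mod c≡0 (walk-mod2 i) ⟩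
    i                    ∎
    where open ≡mod-Reasoning 2

  odd-axis-side : ∀ {c i} → c ≡ 1 mod 2 → i < n →
    IsEdge n W (reflect n c (W i)) (reflect n c (V i))
  odd-axis-side {c} {i} c≡1 i<n
    with injective⇒surjective n W (walk<n n e) injective (reflect n c (V i)) (reflect<n n c (V i))
  ... | j , j<n , Wj≡y = j , j<n , inj₂ (x≡Vj , sym Wj≡y)
    where
    x y : ℕ
    x = reflect n c (W i)
    y = reflect n c (V i)
    j≡i : j ≡ i mod 2
    j≡i = begin
      j            ≈⟨ ≡mod-sym (walk-mod2 j) ⟩
      W j          ≡⟨ Wj≡y ⟩
      y            ≈⟨ reflect-walk-mod2 c (suc i mod' n) ⟩
      c + V i      ≈⟨ +-cong-≡mod c≡1 (next-mod2 i<n) ⟩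
      2 + i        ≈⟨ mod'-≡ refl ⟩
      i            ∎
      where open ≡mod-Reasoning 2
    x≡Vj : x ≡ V j
    x≡Vj = ≡mod⇒≡ (reflect<n n c (W i)) (walk<n n e (suc j mod' n)) (begin
      x            ≈⟨ ≡mod-sym (reflect-walk-next n e c closed i<n) ⟩
      y + e i      ≡⟨ cong₂ _+_ Wj≡y (alt-cong-mod2 a b j≡i) ⟨
      W j + e j    ≈⟨ ≡mod-sym (walk-next n e closed j<n) ⟩
      V j          ∎)
      where open ≡mod-Reasoning n

  even-axis-side : ∀ {c i} → c ≡ 0 mod 2 → i < n →
    IsEdge n W (reflect n c (W i)) (reflect n c (V i)) → e i + e i ≡ 0 mod n
  even-axis-side {c} {i} c≡0 i<n (j , j<n , inj₁ (x≡Wj , y≡Vj)) =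
    +-cancelˡ-≡mod x (begin
      x + (e i + e i)    ≡⟨ +-assoc x (e i) (e i) ⟨
      x + e i + e i      ≡⟨ cong (_+ e i) (cong₂ _+_ x≡Wj ej≡ei) ⟩
      W j + e j + e i    ≈⟨ +-cong-≡mod (≡mod-sym (walk-next n e closed j<n)) ≡mod-refl ⟩
      V j + e i          ≡⟨ cong (_+ e i) y≡Vj ⟨
      y + e i            ≈⟨ reflect-walk-next n e c closed i<n ⟩
      x                  ≡⟨ +-identityʳ x ⟨
      x + 0              ∎)
    where
    open ≡mod-Reasoning n
    x y : ℕ
    x = reflect n c (W i)
    y = reflect n c (V i)
    ej≡ei : e i ≡ e j
    ej≡ei = alt-cong-mod2 a b (≡mod-trans (≡mod-sym (reflect-walk-even c≡0 i))
                                          (≡mod-trans (≡⇒≡mod x≡Wj) (walk-mod2 j)))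
  even-axis-side {c} {i} c≡0 i<n (j , j<n , inj₂ (x≡Vj , y≡Wj)) = ⊥-elim (n≢1+n-mod2 j j≡1+j)
    where
    x y : ℕ
    x = reflect n c (W i)
    y = reflect n c (V i)
    ej≡ei : e j ≡ e i
    ej≡ei = ≡mod⇒≡ (sides<n j) (sides<n i) (+-cancelˡ-≡mod y (begin
      y + e j      ≡⟨ cong (_+ e j) y≡Wj ⟩
      W j + e j    ≈⟨ ≡mod-sym (walk-next n e closed j<n) ⟩
      V j          ≡⟨ x≡Vj ⟨
      x            ≈⟨ ≡mod-sym (reflect-walk-next n e c closed i<n) ⟩
      y + e i      ∎))
      where open ≡mod-Reasoning n
    j≡1+j : j ≡ suc j mod 2
    j≡1+j = begin
      j            ≈⟨ alt-injective-mod2 (<⇒≢ a<b) ej≡ei ⟩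
      i            ≈⟨ ≡mod-sym (reflect-walk-even c≡0 i) ⟩
      x            ≡⟨ x≡Vj ⟩
      V j          ≈⟨ next-mod2 j<n ⟩
      suc j        ∎
      where open ≡mod-Reasoning 2

  even-not-axis : ∀ {c} → c ≡ 0 mod 2 → ¬ IsAxis n W c
  even-not-axis c≡0 (_ , reflection-edges) = <-irrefl (trans a+a≡n (sym b+b≡n)) (+-mono-< a<b a<b)
    where
    1<n : 1 < n
    1<n = ≤-<-trans 1≤a (<-trans a<b b<n)
    a+a≡n : a + a ≡ n
    a+a≡n = m+m≡0-mod⇒m+m≡n 1≤a (<-trans a<b b<n)
              (even-axis-side c≡0 (>-nonZero⁻¹ n) (reflection-edges 0 (>-nonZero⁻¹ n)))
    b+b≡n : b + b ≡ n
    b+b≡n = m+m≡0-mod⇒m+m≡n (<-≤-trans 1≤a (<⇒≤ a<b)) b<n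
              (even-axis-side c≡0 1<n (reflection-edges 1 1<n))

  odd-axis : ∀ {c} → c ≡ 1 mod 2 → c < n → IsAxis n W c
  odd-axis c≡1 c<n = c<n , λ i i<n → odd-axis-side c≡1 i<n

  axis⇒odd : ∀ {c} → IsAxis n W c → c ≡ 1 mod 2
  axis⇒odd {c} axis with mod2-cases c
  ... | inj₁ c≡0 = ⊥-elim (even-not-axis c≡0 axis)
  ... | inj₂ c≡1 = c≡1

  axes : HasExactlyAxes n W m
  axes = odds-below m , odds-below-unique m , length-odds-below m , λ c → mk⇔
    (λ c∈odds → let c≡1 , c<n = Equivalence.to ∈-odds-below c∈odds in odd-axis c≡1 c<n)
    (λ axis → Equivalence.from ∈-odds-below (axis⇒odd axis , proj₁ axis))

module Necessary (m a b : ℕ) {{_ : NonZero m}}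
  (represents : Represents (2 * m) (alt a b)) (a<b : a < b) where

  private
    n s : ℕ
    n = 2 * m
    s = a + b
    e W : ℕ → ℕ
    e = alt a b
    W = walk n e
    instance
      n≢0 : NonZero n
      n≢0 = m*n≢0 2 m

  open AltWalk n a b

  sides-range : ∀ i → i < n → 1 ≤ e i × e i ≤ n ∸ 1
  sides-range = proj₁ represents

  injective : ∀ i j → i < n → j < n → W i ≡ W j → i ≡ j
  injective = proj₁ (proj₂ represents)

  closed : W n ≡ 0
  closed = proj₂ (proj₂ represents)

  0<n : 0 < n
  0<n = >-nonZero⁻¹ n

  1<n : 1 < n
  1<n = *-monoʳ-≤ 2 (>-nonZero⁻¹ m)

  2∣s : 2 ∣ s
  2∣s = *-cancelʳ-∣ m (subst (n ∣_) (*-comm m s) (≡0mod⇒∣ m*s≡0))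
    where
    m*s≡0 : m * s ≡ 0 mod n
    m*s≡0 = ≡mod-trans (≡mod-sym (walk-alt-2* m)) (≡⇒≡mod closed)

  b≡a-mod2 : b ≡ a mod 2
  b≡a-mod2 = +-cancelˡ-≡mod a (≡mod-trans (∣⇒≡0mod 2∣s) (≡mod-sym (n+n≡0-mod2 a)))

  -- The walk must reach the odd vertex 1, so the sides cannot all be even.
  a≢0-mod2 : ¬ a ≡ 0 mod 2
  a≢0-mod2 a≡0 =
    n≢1+n-mod2 0 (≡mod-sym (reaches-1 (injective⇒surjective n W (walk<n n e) injective 1 1<n)))
    where
    reaches-1 : (∃ λ j → j < n × W j ≡ 1) → 1 ≡ 0 mod 2
    reaches-1 (j , _ , Wj≡1) = begin
      1        ≡⟨ Wj≡1 ⟨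
      W j      ≈⟨ walk-alt-mod2 (m∣m*n m) a≡0 (≡mod-trans b≡a-mod2 a≡0) j ⟩
      j * 0    ≡⟨ *-zeroʳ j ⟩
      0        ∎
      where open ≡mod-Reasoning 2

  a≡1-mod2 : a ≡ 1 mod 2
  a≡1-mod2 with mod2-cases a
  ... | inj₁ a≡0 = ⊥-elim (a≢0-mod2 a≡0)
  ... | inj₂ a≡1 = a≡1

  p*s≡0⇒n≤2p : ∀ p → 0 < p → p * s ≡ 0 mod n → n ≤ 2 * p
  p*s≡0⇒n≤2p p 0<p ps≡0 = ≮⇒≥ λ 2p<n →
    <-irrefl (sym (m+n≡0⇒m≡0 p (injective (2 * p) 0 2p<n 0<n W[2p]≡0))) 0<p
    where
    W[2p]≡0 : W (2 * p) ≡ 0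
    W[2p]≡0 = ≡mod⇒≡ (walk<n n e (2 * p)) 0<n (≡mod-trans (walk-alt-2* p) ps≡0)

  gcd≤2 : gcd s n ≤ 2
  gcd≤2 = *-cancelˡ-≤ p {{p≢0}} (begin
    p * G      ≡⟨ m∣n⇒n≡quotient*m G∣n ⟨
    n          ≤⟨ p*s≡0⇒n≤2p p (>-nonZero⁻¹ p {{p≢0}}) (∣⇒≡0mod (divides q p*s≡q*n)) ⟩
    2 * p      ≡⟨ *-comm 2 p ⟩
    p * 2      ∎)
    where
    open ≤-Reasoning
    G p q : ℕ
    G = gcd s n
    G∣n : G ∣ n
    G∣n = gcd[m,n]∣n s n
    p = quotient G∣n
    q = quotient (gcd[m,n]∣m s n)
    p≢0 : NonZero p
    p≢0 = quotient≢0 G∣n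
    p*s≡q*n : p * s ≡ q * n
    p*s≡q*n = begin-equality
      p * s          ≡⟨ cong (p *_) (m∣n⇒n≡quotient*m (gcd[m,n]∣m s n)) ⟩
      p * (q * G)    ≡⟨ *-assoc p q G ⟨
      p * q * G      ≡⟨ cong (_* G) (*-comm p q) ⟩
      q * p * G      ≡⟨ *-assoc q p G ⟩
      q * (p * G)    ≡⟨ cong (q *_) (m∣n⇒n≡quotient*m G∣n) ⟨
      q * n          ∎

  gcd≡2 : gcd s n ≡ 2
  gcd≡2 = ≤-antisym gcd≤2 (∣⇒≤ {{G≢0}} (gcd-greatest 2∣s (m∣m*n m)))
    where
    G≢0 : NonZero (gcd s n)
    G≢0 = ≢-nonZero (gcd[m,n]≢0 s n (inj₂ (≢-nonZero⁻¹ n)))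

  props : Props n a b
  props = ≡-mod' a≡1-mod2 , ≡-mod' (≡mod-trans b≡a-mod2 a≡1-mod2)
        , (proj₁ (sides-range 0 0<n) , a<b , proj₂ (sides-range 1 1<n))
        , gcd≡2

rotated-walk-sides : ∀ n .{{_ : NonZero n}} e e′ {r t} → walk n e n ≡ 0 →
  (∀ j → e j < n) → (∀ j → e′ j < n) →
  (∀ i → i < n → walk n e′ i ≡ (walk n e ((i + t) mod' n) + r) mod' n) →
  ∀ i → suc i < n → e′ i ≡ e ((i + t) mod' n)
rotated-walk-sides n e e′ {r} {t} closed e<n e′<n rotated i 1+i<n =
  ≡mod⇒≡ (e′<n i) (e<n u) (+-cancelˡ-≡mod (σ u + r) (begin
    σ u + r + e′ i                          ≈⟨ +-cong-≡mod (≡mod-sym τi≡σu+r) ≡mod-refl ⟩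
    τ i + e′ i                              ≈⟨ ≡mod-sym (walk-suc n e′ i) ⟩
    τ (suc i)                               ≡⟨ rotated (suc i) 1+i<n ⟩
    (σ ((suc i + t) mod' n) + r) mod' n     ≈⟨ mod'-≡mod n _ ⟩
    σ ((suc i + t) mod' n) + r              ≡⟨ cong (λ k → σ k + r) index ⟩
    σ (suc u mod' n) + r                    ≈⟨ +-cong-≡mod (walk-next n e closed (mod'<n n _)) ≡mod-refl ⟩
    σ u + e u + r                           ≡⟨ +-assoc (σ u) (e u) r ⟩
    σ u + (e u + r)                         ≡⟨ cong (σ u +_) (+-comm (e u) r) ⟩
    σ u + (r + e u)                         ≡⟨ +-assoc (σ u) r (e u) ⟨
    σ u + r + e u                           ∎))
  where
  open ≡mod-Reasoning n
  σ τ : ℕ → ℕ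
  σ = walk n e
  τ = walk n e′
  u : ℕ
  u = (i + t) mod' n
  τi≡σu+r : τ i ≡ σ u + r mod n
  τi≡σu+r = ≡mod-trans (≡⇒≡mod (rotated i (<-trans (n<1+n i) 1+i<n))) (mod'-≡mod n _)
  index : (suc i + t) mod' n ≡ suc u mod' n
  index = ≡-mod' (+-cong-≡mod (≡mod-refl {x = 1}) (≡mod-sym (mod'-≡mod n (i + t))))

ordered-pair : ∀ {a b x y} → a < b → x ≡ a ⊎ x ≡ b → y ≡ a ⊎ y ≡ b → x < y → a ≡ x × b ≡ y
ordered-pair _   (inj₁ refl) (inj₂ refl) _   = refl , refl
ordered-pair _   (inj₁ refl) (inj₁ refl) x<y = ⊥-elim (<-irrefl refl x<y)
ordered-pair _   (inj₂ refl) (inj₂ refl) x<y = ⊥-elim (<-irrefl refl x<y)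
ordered-pair a<b (inj₂ refl) (inj₁ refl) b<a = ⊥-elim (<-asym a<b b<a)

rotation-fixes-sides : ∀ m {{_ : NonZero m}} {a b a′ b′} → 2 < 2 * m →
  Props (2 * m) a b → Props (2 * m) a′ b′ →
  Equivalent (2 * m) (walk (2 * m) (alt a b)) (walk (2 * m) (alt a′ b′)) → a ≡ a′ × b ≡ b′
rotation-fixes-sides m {a = a} {b} {a′} {b′} 2<n props props′ (r , t , rotated) =
  ordered-pair (a<b props) (side-of-ab 0 (<-trans (n<1+n 1) 2<n)) (side-of-ab 1 2<n) (a<b props′)
  where
  open Sufficient m
  side-of-ab : ∀ i → suc i < 2 * m → alt a′ b′ i ≡ a ⊎ alt a′ b′ i ≡ b
  side-of-ab i 1+i<n = Sum.map (trans shifted) (trans shifted) (alt-cases a b ((i + t) mod' (2 * m)))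
    where
    shifted : alt a′ b′ i ≡ alt a b ((i + t) mod' (2 * m))
    shifted = rotated-walk-sides (2 * m) {{m*n≢0 2 m}} (alt a b) (alt a′ b′)
                (closed props) (sides<n props) (sides<n props′) rotated i 1+i<n

theorem7 : ∀ m → 3 < 2 * m →
    (∀ a b →
      (Represents (2 * m) (alt a b) × HasExactlyAxes (2 * m) (walk (2 * m) (alt a b)) m × a < b)
        ⇔ Props (2 * m) a b)
    × (∀ a b a′ b′ → Props (2 * m) a b → Props (2 * m) a′ b′ →
      Equivalent (2 * m) (walk (2 * m) (alt a b)) (walk (2 * m) (alt a′ b′)) →
      a ≡ a′ × b ≡ b′)
theorem7 zero ()
theorem7 m@(suc _) 3<n =
  (λ a b → mk⇔ (λ (rep , _ , a<b) → Necessary.props m a b rep a<b)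
               (λ props → represents props , axes props , a<b props))
  , (λ _ _ _ _ → rotation-fixes-sides m (<-trans (n<1+n 2) 3<n))
  where open Sufficient m
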